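{- Let $\mathcal{M}$ be a non-empty static topology model. Consider the procedure REDUCE: while $\mathcal{M}$ contains a redundant sensor, choose (non-deterministically) a sensor $\mathbf{s}$ redundant in the current model and replace the current model by the reduction $\mathcal{M} \setminus \{\mathbf{s}\}$; finally return the current model. For every sequence of choices, REDUCE terminates and returns a non-empty model that contains no redundant sensor.
   Context: A static topology model is a triple $\mathcal{M} = (S, Z, \rho)$ where $S$ is a finite set of sensors, $Z \subseteq \mathcal{P}(S)$ with $\emptyset \notin Z$, every sensor lies in at least one zone, and $\rho(\mathbf{s}) = \{ z \in Z \mid \mathbf{s} \in z\}$. $\mathcal{M}$ is non-empty if $S \neq \emptyset$. A sensor $\mathbf{s}$ is redundant in $\mathcal{M}$ if for every $z \in \rho(\mathbf{s})$ there is $\mathbf{t} \in S$, $\mathbf{t}\neq \mathbf{s}$, with $z \in \rho(\mathbf{t})$. The reduction $\mathcal{M}\setminus\{\mathbf{s}\}$ has sensor set $S \setminus \{\mathbf{s}\}$, zone set $\{z \setminus \{\mathbf{s}\} \mid z \in Z\}$ and the induced range function. -}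

module Defs where

open import Data.Nat using (ℕ)
open import Data.Fin using (Fin)
open import Data.Fin.Subset using (Subset; _∈_; _∉_; _⊆_; _-_; Nonempty; ⊥)
open import Data.List using (List; map)
import Data.List.Membership.Propositional as L
open import Data.Product using (Σ; ∃; _×_; _,_)
open import Relation.Nullary using (¬_)
open import Relation.Binary.PropositionalEquality using (_≡_; _≢_)
open import Relation.Binary.Construct.Closure.ReflexiveTransitive using (Star)
open import Induction.WellFounded using (Acc)

-- Sensors are drawn from an ambient finite type Fin N (any finite sensor set
-- embeds into some Fin N).  A (raw) topology model consists of the sensor set
-- S ⊆ Fin N and the (finite) set of zones Z, represented as a list of subsets
-- of Fin N (list membership = set membership; duplicates are harmless).
record RawModel (N : ℕ) : Set where
  constructor mkModel
  field
    sensors : Subset N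
    zones   : List (Subset N)
open RawModel public

_∈Z_ : ∀ {N} → Subset N → RawModel N → Set
z ∈Z M = z L.∈ zones M

-- ρ(s) ∋ z   iff   z ∈ Z and s ∈ z
_∈ρ_ : ∀ {N} → Subset N × Fin N → RawModel N → Set
(z , s) ∈ρ M = z ∈Z M × s ∈ z

record IsModel {N : ℕ} (M : RawModel N) : Set where
  field
    zones⊆S      : ∀ z → z ∈Z M → z ⊆ sensors M
    noEmptyZone  : ∀ z → z ∈Z M → Nonempty z
    sensorCovered : ∀ s → s ∈ sensors M → ∃ λ z → (z , s) ∈ρ M

NonEmptyModel : ∀ {N} → RawModel N → Set
NonEmptyModel M = Nonempty (sensors M)

Redundant : ∀ {N} → RawModel N → Fin N → Set
Redundant M s =
  s ∈ sensors M ×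
  (∀ z → (z , s) ∈ρ M → ∃ λ t → t ∈ sensors M × t ≢ s × (z , t) ∈ρ M)

HasRedundant : ∀ {N} → RawModel N → Set
HasRedundant M = ∃ λ s → Redundant M s

reduce : ∀ {N} → RawModel N → Fin N → RawModel N
reduce M s = mkModel (sensors M - s) (map (λ z → z - s) (zones M))

Step : ∀ {N} → RawModel N → RawModel N → Set
Step M M′ = ∃ λ s → Redundant M s × M′ ≡ reduce M s

StepBack : ∀ {N} → RawModel N → RawModel N → Set
StepBack M′ M = Step M M′

Terminates : ∀ {N} → RawModel N → Set
Terminates M = Acc StepBack M

Reachable : ∀ {N} → RawModel N → RawModel N → Set
Reachable = Star Step

module Submission where

-- A reduction step M ⟶ M ∖ {s} removes a sensor s of M, so
-- the number ∣S∣ of sensors strictly decreases; hence the converse step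
-- relation is well founded (it is contained in the inverse image of _<_ on ℕ
-- under M ↦ ∣S∣), and in particular every run from M is finite.
--
-- Being a well-formed non-empty model is an invariant of a
-- single step: zones z ∖ {s} stay inside S ∖ {s}; a zone containing s also
-- contains another sensor t ≠ s (redundancy), so z ∖ {s} ≠ ∅; sensors other
-- than s keep a covering zone; and S ∖ {s} still contains the partner t of s
-- in some zone covering s.  An invariant of single steps is an invariant of
-- finite runs, so any model reached by REDUCE is a non-empty model, and when
-- the loop stops it has no redundant sensor by the loop condition.

open import Defs
open import Data.Nat using (ℕ; _<_)
open import Data.Nat.Induction using (<-wellFounded)
open import Data.Fin using (Fin; _≟_)
open import Data.Fin.Subset using (Subset; _∈_; _∉_; _-_; _─_; Nonempty; inside; outside; ⁅_⁆; ∣_∣)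
open import Data.Fin.Subset.Properties using (x∈p∧x≢y⇒x∈p-y; x∈p⇒∣p-x∣<∣p∣; p─q⊆p; x∈⁅x⁆)
open import Data.Vec.Base using (_∷_; here; there)
open import Data.List.Membership.Propositional.Properties using (∈-map⁺; ∈-map⁻)
open import Data.Product using (_×_; _,_; ∃)
open import Relation.Nullary using (¬_; yes; no)
open import Relation.Binary.PropositionalEquality using (_≡_; refl; _≢_)
open import Relation.Binary.Construct.Closure.ReflexiveTransitive using (ε; _◅_)
open import Relation.Binary.Construct.On as On using ()
open import Induction.WellFounded using (WellFounded; module Subrelation)

x∈p─q⇒x∉q : ∀ {n} {x : Fin n} {p q : Subset n} → x ∈ p ─ q → x ∉ q
x∈p─q⇒x∉q {p = inside  ∷ p} {inside ∷ q} () here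
x∈p─q⇒x∉q {p = outside ∷ p} {inside ∷ q} () here
x∈p─q⇒x∉q {p = _ ∷ p} {_ ∷ q} (there x∈) (there x∈q) = x∈p─q⇒x∉q x∈ x∈q

x∈p-y⇒x∈p : ∀ {n} {x y : Fin n} {p : Subset n} → x ∈ p - y → x ∈ p
x∈p-y⇒x∈p {y = y} {p} = p─q⊆p p ⁅ y ⁆

x∈p-y⇒x≢y : ∀ {n} {x y : Fin n} {p : Subset n} → x ∈ p - y → x ≢ y
x∈p-y⇒x≢y {y = y} x∈ refl = x∈p─q⇒x∉q x∈ (x∈⁅x⁆ y)

zone-of-reduce : ∀ {N} {M : RawModel N} {s : Fin N} {z′ : Subset N} →
  z′ ∈Z reduce M s → ∃ λ z → z ∈Z M × z′ ≡ z - s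
zone-of-reduce {s = s} z′∈ = ∈-map⁻ (λ z → z - s) z′∈

reduced-zone : ∀ {N} {M : RawModel N} (s : Fin N) {z : Subset N} →
  z ∈Z M → (z - s) ∈Z reduce M s
reduced-zone s = ∈-map⁺ (λ z → z - s)

step-shrinks : ∀ {N} {M M′ : RawModel N} →
  Step M M′ → ∣ sensors M′ ∣ < ∣ sensors M ∣
step-shrinks (s , (s∈S , _) , refl) = x∈p⇒∣p-x∣<∣p∣ s∈S

reduce-terminates : ∀ {N} → WellFounded (StepBack {N})
reduce-terminates =
  Subrelation.wellFounded step-shrinks
    (On.wellFounded (λ M → ∣ sensors M ∣) <-wellFounded)

-- Removing a redundant sensor from a non-empty zone leaves it non-empty:
-- if s was the witness, redundancy supplies another sensor of that zone.
reduced-zone-nonempty : ∀ {N} {M : RawModel N} {s : Fin N} {z : Subset N} →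
  Redundant M s → z ∈Z M → Nonempty z → Nonempty (z - s)
reduced-zone-nonempty {s = s} (_ , partner) z∈Z (t , t∈z) with t ≟ s
... | no t≢s = t , x∈p∧x≢y⇒x∈p-y t∈z t≢s
... | yes refl with partner _ (z∈Z , t∈z)
...   | u , _ , u≢s , _ , u∈z = u , x∈p∧x≢y⇒x∈p-y u∈z u≢s

reduce-preserves-model : ∀ {N} {M : RawModel N} {s : Fin N} →
  IsModel M → Redundant M s → IsModel (reduce M s)
reduce-preserves-model {M = M} {s} isModel red = record
  { zones⊆S       = zones⊆S′
  ; noEmptyZone   = noEmptyZone′
  ; sensorCovered = sensorCovered′
  }
  where
  open IsModel isModel

  zones⊆S′ : ∀ z′ → z′ ∈Z reduce M s → ∀ {t} → t ∈ z′ → t ∈ sensors M - s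
  zones⊆S′ z′ z′∈Z t∈z′ with zone-of-reduce {M = M} z′∈Z
  ... | z , z∈Z , refl =
    x∈p∧x≢y⇒x∈p-y (zones⊆S z z∈Z (x∈p-y⇒x∈p t∈z′)) (x∈p-y⇒x≢y t∈z′)

  noEmptyZone′ : ∀ z′ → z′ ∈Z reduce M s → Nonempty z′
  noEmptyZone′ z′ z′∈Z with zone-of-reduce {M = M} z′∈Z
  ... | z , z∈Z , refl = reduced-zone-nonempty red z∈Z (noEmptyZone z z∈Z)

  sensorCovered′ : ∀ t → t ∈ sensors M - s → ∃ λ z′ → (z′ , t) ∈ρ reduce M s
  sensorCovered′ t t∈S′ with sensorCovered t (x∈p-y⇒x∈p t∈S′)
  ... | z , z∈Z , t∈z =
    z - s , reduced-zone {M = M} s z∈Z , x∈p∧x≢y⇒x∈p-y t∈z (x∈p-y⇒x≢y t∈S′)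

-- Removing a redundant sensor never empties the model: s lies in some zone,
-- and that zone contains a further sensor t ≠ s, which survives.
reduce-nonempty : ∀ {N} {M : RawModel N} {s : Fin N} →
  IsModel M → Redundant M s → NonEmptyModel (reduce M s)
reduce-nonempty {s = s} isModel (s∈S , partner)
  with IsModel.sensorCovered isModel s s∈S
... | z , s∈ρ with partner z s∈ρ
...   | t , t∈S , t≢s , _ = t , x∈p∧x≢y⇒x∈p-y t∈S t≢s

GoodModel : ∀ {N} → RawModel N → Set
GoodModel M = IsModel M × NonEmptyModel M

step-preserves-good : ∀ {N} {M M′ : RawModel N} →
  Step M M′ → GoodModel M → GoodModel M′
step-preserves-good (s , red , refl) (isModel , _) =
  reduce-preserves-model isModel red , reduce-nonempty isModel red

reachable-preserves : ∀ {N} (P : RawModel N → Set) →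
  (∀ {M M′} → Step M M′ → P M → P M′) →
  ∀ {M M′} → Reachable M M′ → P M → P M′
reachable-preserves P preserve ε          pM = pM
reachable-preserves P preserve (st ◅ run) pM =
  reachable-preserves P preserve run (preserve st pM)

mainTheorem6 : {N : ℕ} (M : RawModel N) → IsModel M → NonEmptyModel M →
    Terminates M ×
    ((M′ : RawModel N) → Reachable M M′ → ¬ HasRedundant M′ →
    IsModel M′ × NonEmptyModel M′ × ¬ HasRedundant M′)
mainTheorem6 M isModel nonEmpty = reduce-terminates M , result
  where
  result : ∀ M′ → Reachable M M′ → ¬ HasRedundant M′ →
    IsModel M′ × NonEmptyModel M′ × ¬ HasRedundant M′
  result M′ run stopped =
    let (isModel′ , nonEmpty′) =
          reachable-preserves GoodModel step-preserves-good run (isModel , nonEmpty)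
    in isModel′ , nonEmpty′ , stopped
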